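{- For integers $s,t\ge 2$, $$r\!\left(K_{n,n},K_{s,st},\,s^2t-t(s-1)+1\right)=\Omega\!\left(n^{1+1/t}\right).$$
   Context: For graphs $G,H$ and an integer $q$ with $2\le q\le |E(H)|$, an $(H,q)$-coloring of $G$ is an edge-coloring of $G$ in which every subgraph of $G$ isomorphic to $H$ receives at least $q$ distinct colors; $r(G,H,q)$ is the minimum number of colors needed for $G$ to have an $(H,q)$-coloring. $K_{a,b}$ denotes the complete bipartite graph with parts of sizes $a$ and $b$. Asymptotic notation refers to $n\to\infty$ with $s,t$ fixed. -}

module Defs where

open import Data.Nat using (ℕ; _*_; _+_; _∸_)
open import Data.Fin using (Fin)
open import Data.Product using (Σ; _×_; _,_)
open import Relation.Binary.PropositionalEquality using (_≡_)
open import Function.Definitions using (Injective)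

-- The complete bipartite graph K_{n,n}: left vertices Fin n, right vertices Fin n,
-- and an edge (i , j) for every left vertex i and right vertex j.
Coloring : ℕ → ℕ → Set
Coloring n k = Fin n → Fin n → Fin k

AtLeastDistinct : {E : Set} {k : ℕ} → ℕ → (E → Fin k) → Set
AtLeastDistinct {E} q col = Σ (Fin q → E) λ e → Injective _≡_ _≡_ (λ x → col (e x))

-- A subgraph of K_{n,n} isomorphic to K_{a,b} is given by injective maps
-- f : Fin a → Fin n and g : Fin b → Fin n, where the a-side lies on the left
-- and the b-side on the right, or vice versa.
-- (H,q)-coloring of K_{n,n} with H = K_{a,b}:
IsKabqColoring : (n a b q : ℕ) {k : ℕ} → Coloring n k → Set
IsKabqColoring n a b q c =
  (f : Fin a → Fin n) → (g : Fin b → Fin n) →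
  Injective _≡_ _≡_ f → Injective _≡_ _≡_ g →
  AtLeastDistinct q (λ (e : Fin a × Fin b) → let (x , y) = e in c (f x) (g y))
  × AtLeastDistinct q (λ (e : Fin a × Fin b) → let (x , y) = e in c (g y) (f x))

-- Any copy of K_{a,b} in which r edges take only p colours shows at most ab − r + p colours.  For
-- K_{s,st} and our q this rules out a monochromatic star with st leaves, and also s vertices each
-- joined to t blocks of vertices by edges coloured b₁, …, b_t, block by block.  Splitting the right
-- side into t blocks of size ⌊n/t⌋, every colour tuple (c(u, y₁), …, c(u, y_t)), y_i in block i, is
-- therefore realised by at most s vertices u in at most (st)^t ways each: n ⌊n/t⌋^t ≤ s (st)^t k^t.

module Submission where

open import Level using (Level)
open import Data.Bool.Base using (if_then_else_)
open import Data.Fin.Base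
  using (Fin; zero; suc; _↑ˡ_; _↑ʳ_; combine; remQuot; quotient; remainder; inject≤; fromℕ<; finToFun; funToFin)
open import Data.Fin.Properties
  using (_≟_; any?; all?; ¬∀⟶∃¬; suc-injective; injective⇒≤; inject≤-injective;
         combine-injective; combine-injectiveʳ; remQuot-combine; combine-remQuot; finToFun-funToFin)
open import Data.Nat.Base using (ℕ; zero; suc; _+_; _*_; _∸_; _^_; _≤_; _<_; z≤n; s≤s; NonZero; >-nonZero; >-nonZero⁻¹)
open import Data.Nat.Properties
  using (≤-trans; ≤-reflexive; <⇒≤; <⇒≱; ≰⇒>; ≤-<-trans; m≤n⇒m≤1+n; m≤m*n; m≤n*m; m+n∸m≡n;
         +-suc; +-assoc; +-comm; *-comm; *-assoc; +-mono-≤; +-monoˡ-≤; +-monoʳ-≤; *-monoˡ-≤; *-monoʳ-≤;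
         ^-monoˡ-≤; *-commutativeSemigroup; module ≤-Reasoning)
open import Data.Nat.DivMod using (_/_; _%_; m≡m%n+[m/n]*n; m%n<n; m/n*n≤m; m≥n⇒m/n>0)
open import Data.Nat.Tactic.RingSolver using (solve-∀)
open import Algebra.Properties.CommutativeSemigroup *-commutativeSemigroup using (interchange; x∙yz≈y∙xz)
open import Data.Product.Base using (Σ; ∃; _×_; _,_; proj₁; proj₂; uncurry)
open import Data.Vec.Functional using (_∷_)
open import Function.Base using (_∘_; id)
open import Function.Definitions using (Injective)
open import Relation.Binary.PropositionalEquality
  using (_≡_; _≢_; refl; sym; trans; cong; cong₂; subst; module ≡-Reasoning)
open import Relation.Nullary.Decidable.Core using (yes; no; does; _×-dec_)
open import Relation.Nullary.Negation using (¬_; contradiction)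
open import Relation.Unary using (Pred; Decidable; _⊆_)
open import Relation.Unary.Properties using (∁?; U?)

open import Defs

private variable
  ℓ ℓ′ : Level
  a b k m n p q r t M : ℕ

count : {P : Pred (Fin n) ℓ} → Decidable P → ℕ
count {zero}  P? = 0
count {suc n} P? = (if does (P? zero) then suc else id) (count (P? ∘ suc))

count-mono : {P : Pred (Fin n) ℓ} {Q : Pred (Fin n) ℓ′} (P? : Decidable P) (Q? : Decidable Q) →
             P ⊆ Q → count P? ≤ count Q?
count-mono {zero}  P? Q? P⊆Q = z≤n
count-mono {suc n} P? Q? P⊆Q with P? zero | Q? zero
... | yes _ | yes _ = s≤s (count-mono (P? ∘ suc) (Q? ∘ suc) P⊆Q)
... | yes p | no ¬q = contradiction (P⊆Q p) ¬q
... | no _  | yes _ = m≤n⇒m≤1+n (count-mono (P? ∘ suc) (Q? ∘ suc) P⊆Q)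
... | no _  | no _  = count-mono (P? ∘ suc) (Q? ∘ suc) P⊆Q

count-none : {P : Pred (Fin n) ℓ} (P? : Decidable P) → (∀ x → ¬ P x) → count P? ≡ 0
count-none {zero}  P? ¬P = refl
count-none {suc n} P? ¬P with P? zero
... | yes p = contradiction p (¬P zero)
... | no _  = count-none (P? ∘ suc) (¬P ∘ suc)

count-complement : {P : Pred (Fin n) ℓ} (P? : Decidable P) → count P? + count (∁? P?) ≡ n
count-complement {zero}  P? = refl
count-complement {suc n} P? with P? zero
... | yes _ = cong suc (count-complement (P? ∘ suc))
... | no _  = trans (+-suc _ _) (cong suc (count-complement (P? ∘ suc)))

count-++ : ∀ m {n} {P : Pred (Fin (m + n)) ℓ} (P? : Decidable P) →
           count P? ≡ count (P? ∘ (_↑ˡ n)) + count (P? ∘ (m ↑ʳ_))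
count-++ zero    P? = refl
count-++ (suc m) P? with P? zero
... | yes _ = cong suc (count-++ m (P? ∘ suc))
... | no _  = count-++ m (P? ∘ suc)

select : {P : Pred (Fin n) ℓ} (P? : Decidable P) → Fin (count P?) → Fin n
select {suc n} P? i with P? zero
select P? zero    | yes _ = zero
select P? (suc i) | yes _ = suc (select (P? ∘ suc) i)
select P? i       | no _  = suc (select (P? ∘ suc) i)

select-∈ : {P : Pred (Fin n) ℓ} (P? : Decidable P) (i : Fin (count P?)) → P (select P? i)
select-∈ {suc n} P? i with P? zero
select-∈ P? zero    | yes p = p
select-∈ P? (suc i) | yes _ = select-∈ (P? ∘ suc) i
select-∈ P? i       | no _  = select-∈ (P? ∘ suc) i

select-injective : {P : Pred (Fin n) ℓ} (P? : Decidable P) → Injective _≡_ _≡_ (select P?)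
select-injective {suc n} P? {i} {j} eq with P? zero
select-injective P? {zero}  {zero}  eq | yes _ = refl
select-injective P? {suc i} {suc j} eq | yes _ = cong suc (select-injective (P? ∘ suc) (suc-injective eq))
select-injective P? {i}     {j}     eq | no _  = select-injective (P? ∘ suc) (suc-injective eq)

index : {P : Pred (Fin n) ℓ} (P? : Decidable P) {x : Fin n} → P x → Fin (count P?)
index {suc n} P? {x} px with P? zero
index P? {zero}  px | yes _ = zero
index P? {suc x} px | yes _ = suc (index (P? ∘ suc) px)
index P? {zero}  px | no ¬p = contradiction px ¬p
index P? {suc x} px | no _  = index (P? ∘ suc) px

index-injective : {P : Pred (Fin n) ℓ} (P? : Decidable P) {x y : Fin n} (px : P x) (py : P y) →
                  index P? px ≡ index P? py → x ≡ y
index-injective {suc n} P? {x} {y} px py eq with P? zero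
index-injective P? {zero}  {zero}  px py eq | yes _ = refl
index-injective P? {suc x} {suc y} px py eq | yes _ =
  cong suc (index-injective (P? ∘ suc) px py (suc-injective eq))
index-injective P? {zero}  {_}     px py eq | no ¬p = contradiction px ¬p
index-injective P? {suc x} {zero}  px py eq | no ¬p = contradiction py ¬p
index-injective P? {suc x} {suc y} px py eq | no _  =
  cong suc (index-injective (P? ∘ suc) px py eq)

count-≤-injection : {P : Pred (Fin n) ℓ} (P? : Decidable P) (f : ∀ {x} → P x → Fin m) →
                    (∀ {x y} (px : P x) (py : P y) → f px ≡ f py → x ≡ y) → count P? ≤ m
count-≤-injection P? f f-injective =
  injective⇒≤ {f = f ∘ select-∈ P?} (select-injective P? ∘ f-injective _ _)

injection-≤-count : {Q : Pred (Fin n) ℓ} (Q? : Decidable Q) (h : Fin m → Fin n) →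
                    Injective _≡_ _≡_ h → (∀ x → Q (h x)) → m ≤ count Q?
injection-≤-count Q? h h-injective h-∈ =
  injective⇒≤ {f = index Q? ∘ h-∈} (h-injective ∘ index-injective Q? _ _)

count-≤ : {P : Pred (Fin n) ℓ} (P? : Decidable P) → count P? ≤ n
count-≤ P? = count-≤-injection P? (λ {x} _ → x) (λ _ _ → id)

injection-from-count : {P : Pred (Fin n) ℓ} (P? : Decidable P) → m ≤ count P? →
                       Σ (Fin m → Fin n) λ g → Injective _≡_ _≡_ g × (∀ i → P (g i))
injection-from-count P? m≤count =
  select P? ∘ embed ,
  (λ eq → inject≤-injective m≤count m≤count _ _ (select-injective P? eq)) ,
  select-∈ P? ∘ embed
  where
  embed = λ i → inject≤ i m≤count

count-combine-≤ : ∀ m {n R} {P : Pred (Fin (m * n)) ℓ} {S : Pred (Fin m) ℓ′}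
                  (P? : Decidable P) (S? : Decidable S) →
                  (∀ (u : Fin m) → count (P? ∘ combine u) ≤ R) →
                  (∀ {u : Fin m} {z : Fin n} → P (combine u z) → S u) →
                  count P? ≤ count S? * R
count-combine-≤ zero    P? S? rows support = z≤n
count-combine-≤ (suc m) {n} P? S? rows support
  rewrite count-++ n P?
  with S? zero | count-combine-≤ m (P? ∘ (n ↑ʳ_)) (S? ∘ suc) (rows ∘ suc) (λ {u} {z} → support {suc u} {z})
... | yes _ | later-rows = +-mono-≤ (rows zero) later-rows
... | no ¬s | later-rows = ≤-trans (+-monoˡ-≤ _ (≤-reflexive first-row-empty)) later-rows
  where
  first-row-empty : count (P? ∘ combine {suc m} {n} zero) ≡ 0
  first-row-empty = count-none (P? ∘ combine {suc m} {n} zero) (λ z → ¬s ∘ support {zero} {z})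

count-remQuot-≤ : ∀ m {n R} {P : Fin m → Pred (Fin n) ℓ} {S : Pred (Fin m) ℓ′}
                  (P? : ∀ u → Decidable (P u)) (S? : Decidable S) →
                  (∀ u → count (P? u) ≤ R) → (∀ {u z} → P u z → S u) →
                  count (λ x → P? (quotient n x) (remainder {m} n x)) ≤ count S? * R
count-remQuot-≤ m {n} {P = P} P? S? rows support =
  count-combine-≤ m _ S? (λ u → ≤-trans (count-mono _ (P? u) decode) (rows u)) (support ∘ decode)
  where
  decode : ∀ {u z} → P (quotient n (combine u z)) (remainder {m} n (combine u z)) → P u z
  decode {u} {z} = subst (uncurry P) (remQuot-combine u z)

count-tuples-≤ : ∀ t {B R} {Q : Fin t → Pred (Fin B) ℓ} (Q? : ∀ i → Decidable (Q i)) →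
                 (∀ i → count (Q? i) ≤ R) → count (λ z → all? (λ i → Q? i (finToFun z i))) ≤ R ^ t
count-tuples-≤ zero    Q? bound = count-≤ (λ z → all? (λ i → Q? i (finToFun z i)))
count-tuples-≤ (suc t) {B} {R} Q? bound = begin
  count Tuple?                      ≤⟨ count-mono Tuple? Head×Tail? (λ Qz → Qz zero , Qz ∘ suc) ⟩
  count Head×Tail?                  ≤⟨ count-remQuot-≤ B Head? (Q? zero) rows proj₁ ⟩
  count (Q? zero) * R ^ t           ≤⟨ *-monoˡ-≤ (R ^ t) (bound zero) ⟩
  R * R ^ t                         ∎
  where
  open ≤-Reasoning
  Tuple? = λ z → all? (λ i → Q? i (finToFun z i))
  Tail? = λ z → all? (λ i → Q? (suc i) (finToFun z i))
  Head? = λ y z → Q? zero y ×-dec Tail? z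
  -- finToFun z zero is the quotient of z, and finToFun z ∘ suc is finToFun of its remainder.
  Head×Tail? = λ x → Head? (quotient (B ^ t) x) (remainder {B} (B ^ t) x)
  rows : ∀ y → count (Head? y) ≤ R ^ t
  rows y = ≤-trans (count-mono (Head? y) Tail? proj₂) (count-tuples-≤ t (Q? ∘ suc) (bound ∘ suc))

fibres-≤ : ∀ {A K R} (f : Fin A → Fin K) → (∀ b → count (λ x → f x ≟ b) ≤ R) → A ≤ K * R
fibres-≤ {A} {K} {R} f fibre = begin
  A                ≤⟨ injection-≤-count Graph? (λ x → combine (f x) x) graph-injective on-graph ⟩
  count Graph?     ≤⟨ count-remQuot-≤ K (λ b x → f x ≟ b) All? fibre _ ⟩
  count All? * R   ≤⟨ *-monoˡ-≤ R (count-≤ All?) ⟩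
  K * R            ∎
  where
  open ≤-Reasoning
  All? = U? {A = Fin K}
  -- The graph of f, as a subset of Fin (K * A), counted row by row.
  Graph? = λ z → f (remainder {K} A z) ≟ quotient A z
  graph-injective : Injective _≡_ _≡_ (λ x → combine (f x) x)
  graph-injective {x} {y} = combine-injectiveʳ (f x) x (f y) y
  on-graph : ∀ x → f (remainder {K} A (combine (f x) x)) ≡ quotient A (combine (f x) x)
  on-graph x = subst (uncurry λ b y → f y ≡ b) (sym (remQuot-combine (f x) x)) refl

fresh : m < n → (g : Fin m → Fin n) → ∃ λ v → ∀ x → g x ≢ v
fresh {m} {n} m<n g with ¬∀⟶∃¬ n (λ v → ∃ λ x → g x ≡ v) (λ v → any? (λ x → g x ≟ v)) ¬surjective
  where
  ¬surjective : ¬ (∀ v → ∃ λ x → g x ≡ v)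
  ¬surjective hit = <⇒≱ m<n (injective⇒≤ {f = proj₁ ∘ hit} λ {v} {v′} eq →
    trans (sym (proj₂ (hit v))) (trans (cong g eq) (proj₂ (hit v′))))
... | v , ¬hit = v , λ x gx≡v → ¬hit (x , gx≡v)

fresh-∷-injective : {v : Fin n} {g : Fin m → Fin n} →
                    (∀ x → g x ≢ v) → Injective _≡_ _≡_ g → Injective _≡_ _≡_ (v ∷ g)
fresh-∷-injective v-fresh g-injective {zero}  {zero}  eq = refl
fresh-∷-injective v-fresh g-injective {zero}  {suc y} eq = contradiction (sym eq) (v-fresh y)
fresh-∷-injective v-fresh g-injective {suc x} {zero}  eq = contradiction eq (v-fresh x)
fresh-∷-injective v-fresh g-injective {suc x} {suc y} eq = cong suc (g-injective eq)

cover : (h : Fin m → Fin n) → m ≤ n →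
        Σ (Fin m → Fin n) λ g → Injective _≡_ _≡_ g × (∀ x → ∃ λ x′ → g x′ ≡ h x)
cover {zero}  h _   = (λ ()) , (λ {x} → contradiction x λ ()) , λ ()
cover {suc m} h m<n with cover (h ∘ suc) (<⇒≤ m<n)
... | g , g-injective , g-covers =
  proj₁ new ∷ g , fresh-∷-injective (proj₁ (proj₂ new)) g-injective , covers
  where
  new : Σ (Fin _) λ v → (∀ x → g x ≢ v) × ∃ λ x′ → (v ∷ g) x′ ≡ h zero
  new with any? (λ x → g x ≟ h zero)
  ... | yes (x , gx≡h₀) = proj₁ (fresh m<n g) , proj₂ (fresh m<n g) , suc x , gx≡h₀
  ... | no h₀∉g         = h zero , (λ x gx≡h₀ → h₀∉g (x , gx≡h₀)) , zero , refl
  covers : ∀ x → ∃ λ x′ → (proj₁ new ∷ g) x′ ≡ h x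
  covers zero    = proj₂ (proj₂ new)
  covers (suc x) = suc (proj₁ (g-covers x)) , proj₂ (g-covers x)

-- D is the image of ι: the rainbow edges inside D have distinct palette colours, so there are at
-- most p of them, and the others lie in the complement of D, which has at most M ∸ r elements.
rainbow-bound : {E : Set} (enc : E → Fin M) → Injective _≡_ _≡_ enc →
                (col : E → Fin k) (e : Fin q → E) → Injective _≡_ _≡_ (col ∘ e) →
                (ι : Fin r → E) → Injective _≡_ _≡_ ι →
                (palette : Fin p → Fin k) (π : Fin r → Fin p) → (∀ j → col (ι j) ≡ palette (π j)) →
                q + r ≤ M + p
rainbow-bound {M = M} {q = q} {r = r} {p = p} enc enc-injective col e rainbow ι ι-injective palette π ι-col =
  let open ≤-Reasoning in begin
  q + r                                           ≤⟨ +-monoʳ-≤ q r≤count ⟩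
  q + count D?                                    ≡⟨ cong (_+ count D?) (count-complement (D? ∘ enc ∘ e)) ⟨
  count (D? ∘ enc ∘ e) + count (∁? D? ∘ enc ∘ e) + count D?
                                                  ≤⟨ +-monoˡ-≤ (count D?) (+-mono-≤ inside outside) ⟩
  p + count (∁? D?) + count D?                    ≡⟨ +-assoc p _ _ ⟩
  p + (count (∁? D?) + count D?)                  ≡⟨ cong (p +_) (+-comm (count (∁? D?)) (count D?)) ⟩
  p + (count D? + count (∁? D?))                  ≡⟨ cong (p +_) (count-complement D?) ⟩
  p + M                                           ≡⟨ +-comm p M ⟩
  M + p                                           ∎
  where
  D? = λ x → any? (λ j → enc (ι j) ≟ x)
  r≤count : r ≤ count D?
  r≤count = injection-≤-count D? (enc ∘ ι) (ι-injective ∘ enc-injective) (λ j → j , refl)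
  inside : count (D? ∘ enc ∘ e) ≤ p
  inside = count-≤-injection (D? ∘ enc ∘ e) (λ (j , _) → π j) λ (j , ιj≡z) (j′ , ιj′≡z′) πj≡πj′ →
    rainbow (same-colour ιj≡z ιj′≡z′ πj≡πj′)
    where
    same-colour : ∀ {j j′ z z′} → enc (ι j) ≡ enc (e z) → enc (ι j′) ≡ enc (e z′) → π j ≡ π j′ →
                  col (e z) ≡ col (e z′)
    same-colour {j} {j′} {z} {z′} ιj≡z ιj′≡z′ πj≡πj′ = begin
      col (e z)       ≡⟨ cong col (enc-injective ιj≡z) ⟨
      col (ι j)       ≡⟨ ι-col j ⟩
      palette (π j)   ≡⟨ cong palette πj≡πj′ ⟩
      palette (π j′)  ≡⟨ ι-col j′ ⟨
      col (ι j′)      ≡⟨ cong col (enc-injective ιj′≡z′) ⟩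
      col (e z′)      ∎
      where open ≡-Reasoning
  outside : count (∁? D? ∘ enc ∘ e) ≤ count (∁? D?)
  outside = count-≤-injection (∁? D? ∘ enc ∘ e) (index (∁? D?))
    (λ z∉D z′∉D → rainbow ∘ cong col ∘ enc-injective ∘ index-injective (∁? D?) z∉D z′∉D)

palette-bound : {c : Coloring n k} → IsKabqColoring n a b q c →
                (f : Fin a → Fin n) (g : Fin b → Fin n) → Injective _≡_ _≡_ f → Injective _≡_ _≡_ g →
                (ι : Fin r → Fin a × Fin b) → Injective _≡_ _≡_ ι →
                (palette : Fin p → Fin k) (π : Fin r → Fin p) →
                (∀ j → c (f (proj₁ (ι j))) (g (proj₂ (ι j))) ≡ palette (π j)) →
                q + r ≤ a * b + p
palette-bound {c = c} hyp f g f-injective g-injective ι ι-injective palette π ι-col =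
  rainbow-bound (uncurry combine) combine-pair-injective (λ (x , y) → c (f x) (g y))
                (proj₁ rainbow) (proj₂ rainbow) ι ι-injective palette π ι-col
  where
  rainbow = proj₁ (hyp f g f-injective g-injective)
  combine-pair-injective : Injective _≡_ _≡_ (uncurry (combine {_} {_}))
  combine-pair-injective {i , j} {i′ , j′} eq = uncurry (cong₂ _,_) (combine-injective i j i′ j′ eq)

monochromatic-star-bound : {c : Coloring n k} → IsKabqColoring n a b q c → 0 < a → a ≤ n →
                           (u : Fin n) (ws : Fin b → Fin n) → Injective _≡_ _≡_ ws →
                           (colour : Fin k) → (∀ y → c u (ws y) ≡ colour) → q + b ≤ a * b + 1
monochromatic-star-bound {c = c} hyp 0<a a≤n u ws ws-injective colour star-colour =
  palette-bound {c = c} hyp f ws f-injective ws-injective (x₀ ,_) (cong proj₂) (λ _ → colour) (λ _ → zero)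
    λ y → trans (cong (λ v → c v (ws y)) fx₀≡u) (star-colour y)
  where
  star-centre = cover (λ _ → u) a≤n
  f = proj₁ star-centre
  f-injective = proj₁ (proj₂ star-centre)
  u∈f = proj₂ (proj₂ star-centre) (fromℕ< 0<a)
  x₀ = proj₁ u∈f
  fx₀≡u : f x₀ ≡ u
  fx₀≡u = proj₂ u∈f

remQuot-injective : ∀ {m} n → Injective _≡_ _≡_ (remQuot {m} n)
remQuot-injective {m} n {x} {y} eq =
  trans (sym (combine-remQuot {m} n x)) (trans (cong (uncurry combine) eq) (combine-remQuot {m} n y))

block-palette-bound : {c : Coloring n k} → IsKabqColoring n a (a * t) q c → a * t ≤ n →
                      (us : Fin a → Fin n) → Injective _≡_ _≡_ us →
                      (v : Fin a → Fin t → Fin n) → (∀ {j i j′ i′} → v j i ≡ v j′ i′ → i ≡ i′) →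
                      (palette : Fin t → Fin k) → (∀ j i → c (us j) (v j i) ≡ palette i) →
                      q + a * t ≤ a * (a * t) + t
block-palette-bound {a = a} {t = t} {c = c} hyp at≤n us us-injective v blocks palette v-colour =
  palette-bound {c = c} hyp us g us-injective g-injective ι ι-injective palette (remainder {a} t) ι-colour
  where
  -- The vertices v j i may repeat; cover pads them out to a copy of K_{a, at}.
  v′ = λ x → v (quotient {a} t x) (remainder {a} t x)
  padding = cover v′ at≤n
  g = proj₁ padding
  g-injective = proj₁ (proj₂ padding)
  g-covers = proj₂ (proj₂ padding)
  ι = λ x → quotient {a} t x , proj₁ (g-covers x)
  ι-colour : ∀ x → c (us (quotient {a} t x)) (g (proj₁ (g-covers x))) ≡ palette (remainder {a} t x)
  ι-colour x = trans (cong (c (us _)) (proj₂ (g-covers x))) (v-colour _ _)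
  ι-injective : Injective _≡_ _≡_ ι
  ι-injective {x} {y} eq = remQuot-injective {a} t (cong₂ _,_ (cong proj₁ eq) (blocks v′x≡v′y))
    where
    v′x≡v′y : v′ x ≡ v′ y
    v′x≡v′y = trans (sym (proj₂ (g-covers x))) (trans (cong g (cong proj₂ eq)) (proj₂ (g-covers y)))

module _ {n T B k} (φ : Fin n → Fin T → Fin B → Fin k) where

  realises? : (b : Fin T → Fin k) (u : Fin n) → Decidable λ z → ∀ i → φ u i (finToFun z i) ≡ b i
  realises? b u z = all? (λ i → φ u i (finToFun z i) ≟ b i)

  -- Double counting of the pairs (u , y), u a vertex and y i a vertex of block i, by the colour
  -- tuple i ↦ φ u i (y i) they realise; the tuples y are encoded in Fin (B ^ T) by finToFun.
  tuples-≤ : ∀ {R L} → (∀ u i colour → count (λ y → φ u i y ≟ colour) ≤ R) →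
             (∀ b → count (λ u → any? (realises? b u)) ≤ L) → n * B ^ T ≤ k ^ T * (L * R ^ T)
  tuples-≤ {R} {L} degree realisers = fibres-≤ colours fibre
    where
    colours : Fin (n * B ^ T) → Fin (k ^ T)
    colours x = funToFin λ i → φ (quotient (B ^ T) x) i (finToFun (remainder {n} (B ^ T) x) i)
    fibre : ∀ bs → count (λ x → colours x ≟ bs) ≤ L * R ^ T
    fibre bs = begin
      count (λ x → colours x ≟ bs)
        ≤⟨ count-mono (λ x → colours x ≟ bs) Realises?
                      (λ {x} eq i → trans (sym (finToFun-funToFin _ i)) (cong (λ z → finToFun z i) eq)) ⟩
      count Realises?
        ≤⟨ count-remQuot-≤ n (realises? target) (λ u → any? (realises? target u))
                           (λ u → count-tuples-≤ T _ (λ i → degree u i (target i))) (λ {_} {z} r → z , r) ⟩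
      count (λ u → any? (realises? target u)) * R ^ T
        ≤⟨ *-monoˡ-≤ (R ^ T) (realisers target) ⟩
      L * R ^ T ∎
      where
      open ≤-Reasoning
      target = finToFun bs
      Realises? = λ x → realises? target (quotient (B ^ T) x) (remainder {n} (B ^ T) x)

colouring-bound : ∀ {s t n k q} .{{_ : NonZero t}} {c : Coloring n k} → 0 < s → s * t ≤ n →
                  s * (s * t) + t < q + s * t → IsKabqColoring n s (s * t) q c →
                  n * (n / t) ^ t ≤ k ^ t * (s * (s * t) ^ t)
colouring-bound {s} {t} {n} {k} {q} {c} 0<s st≤n excess hyp =
  tuples-≤ φ (λ u i colour → <⇒≤ (monochromatic-< u i colour)) (λ b → <⇒≤ (realisers-< b))
  where
  tB≤n : t * (n / t) ≤ n
  tB≤n = ≤-trans (≤-reflexive (*-comm t (n / t))) (m/n*n≤m n t)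
  w : Fin t → Fin (n / t) → Fin n
  w i y = inject≤ (combine i y) tB≤n
  w-injective : ∀ {i y i′ y′} → w i y ≡ w i′ y′ → i ≡ i′ × y ≡ y′
  w-injective {i} {y} {i′} {y′} eq = combine-injective i y i′ y′ (inject≤-injective tB≤n tB≤n _ _ eq)
  φ = λ u i y → c u (w i y)
  monochromatic-< : ∀ u i colour → count (λ y → c u (w i y) ≟ colour) < s * t
  monochromatic-< u i colour = ≰⇒> λ st≤count →
    let (ys , ys-injective , ys-colour) = injection-from-count _ st≤count in
    <⇒≱ (≤-<-trans (+-monoʳ-≤ (s * (s * t)) (>-nonZero⁻¹ t)) excess)
        (monochromatic-star-bound {c = c} hyp 0<s (≤-trans (m≤m*n s t) st≤n) u (w i ∘ ys)
                                  (ys-injective ∘ proj₂ ∘ w-injective) colour ys-colour)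
  realisers-< : ∀ b → count (λ u → any? (realises? φ b u)) < s
  realisers-< b = ≰⇒> λ s≤count →
    let (us , us-injective , us-realise) = injection-from-count _ s≤count in
    <⇒≱ excess
        (block-palette-bound {c = c} hyp st≤n us us-injective
                             (λ j i → w i (finToFun (proj₁ (us-realise j)) i))
                             (proj₁ ∘ w-injective) b (proj₂ ∘ us-realise))

n≤2*t*[n/t] : ∀ n t .{{_ : NonZero t}} → t ≤ n → n ≤ 2 * t * (n / t)
n≤2*t*[n/t] n t t≤n = begin
  n                          ≡⟨ m≡m%n+[m/n]*n n t ⟩
  n % t + n / t * t          ≤⟨ +-monoˡ-≤ (n / t * t) (≤-trans (<⇒≤ (m%n<n n t)) t≤[n/t]*t) ⟩
  n / t * t + n / t * t      ≡⟨ double (n / t) t ⟩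
  2 * t * (n / t)            ∎
  where
  open ≤-Reasoning
  t≤[n/t]*t : t ≤ n / t * t
  t≤[n/t]*t = m≤n*m t (n / t) {{>-nonZero (m≥n⇒m/n>0 t≤n)}}
  double : ∀ x y → x * y + x * y ≡ 2 * y * x
  double = solve-∀

^-distribʳ-* : ∀ m n o → (m * n) ^ o ≡ m ^ o * n ^ o
^-distribʳ-* m n zero    = refl
^-distribʳ-* m n (suc o) = trans (cong (m * n *_) (^-distribʳ-* m n o)) (interchange m n (m ^ o) (n ^ o))

excess-colours : ∀ s t → 0 < s → s * s * t ∸ t * (s ∸ 1) + 1 + s * t ≡ suc (s * (s * t) + t)
excess-colours (suc s′) t _ = begin
  s * s * t ∸ t * s′ + 1 + s * t                ≡⟨ cong (λ x → x ∸ t * s′ + 1 + s * t) (split s′ t) ⟩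
  t * s′ + (s′ * s * t + t) ∸ t * s′ + 1 + s * t ≡⟨ cong (λ x → x + 1 + s * t) (m+n∸m≡n (t * s′) _) ⟩
  s′ * s * t + t + 1 + s * t                    ≡⟨ regroup s′ t ⟩
  suc (s * (s * t) + t)                         ∎
  where
  open ≡-Reasoning
  s = suc s′
  split : ∀ s′ t → suc s′ * suc s′ * t ≡ t * s′ + (s′ * suc s′ * t + t)
  split = solve-∀
  regroup : ∀ s′ t → s′ * suc s′ * t + t + 1 + suc s′ * t ≡ suc (suc s′ * (suc s′ * t) + t)
  regroup = solve-∀

theorem1p10 : (s t : ℕ) → 2 ≤ s → 2 ≤ t →
    Σ ℕ λ d → Σ ℕ λ N → (n : ℕ) → N ≤ n →
      (k : ℕ) → (c : Coloring n k) →
      IsKabqColoring n s (s * t) (s * s * t ∸ t * (s ∸ 1) + 1) c →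
      n ^ (suc t) ≤ d * k ^ t
theorem1p10 s t 2≤s 2≤t = (2 * t) ^ t * (s * (s * t) ^ t) , s * t , bound
  where
  instance _ = >-nonZero (≤-trans (s≤s z≤n) 2≤t)
  0<s = ≤-trans (s≤s z≤n) 2≤s
  bound : ∀ n → s * t ≤ n → ∀ k (c : Coloring n k) →
          IsKabqColoring n s (s * t) (s * s * t ∸ t * (s ∸ 1) + 1) c →
          n ^ suc t ≤ (2 * t) ^ t * (s * (s * t) ^ t) * k ^ t
  bound n st≤n k c hyp = begin
    n * n ^ t                                  ≤⟨ *-monoʳ-≤ n (^-monoˡ-≤ t (n≤2*t*[n/t] n t t≤n)) ⟩
    n * (2 * t * (n / t)) ^ t                  ≡⟨ cong (n *_) (^-distribʳ-* (2 * t) (n / t) t) ⟩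
    n * ((2 * t) ^ t * (n / t) ^ t)            ≡⟨ x∙yz≈y∙xz n ((2 * t) ^ t) ((n / t) ^ t) ⟩
    (2 * t) ^ t * (n * (n / t) ^ t)            ≤⟨ *-monoʳ-≤ ((2 * t) ^ t) colouring ⟩
    (2 * t) ^ t * (k ^ t * (s * (s * t) ^ t))  ≡⟨ cong ((2 * t) ^ t *_) (*-comm (k ^ t) _) ⟩
    (2 * t) ^ t * (s * (s * t) ^ t * k ^ t)    ≡⟨ *-assoc ((2 * t) ^ t) _ (k ^ t) ⟨
    (2 * t) ^ t * (s * (s * t) ^ t) * k ^ t    ∎
    where
    open ≤-Reasoning
    t≤n : t ≤ n
    t≤n = ≤-trans (m≤n*m t s {{>-nonZero 0<s}}) st≤n
    colouring : n * (n / t) ^ t ≤ k ^ t * (s * (s * t) ^ t)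
    colouring = colouring-bound {c = c} 0<s st≤n (≤-reflexive (sym (excess-colours s t 0<s))) hyp
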